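{- Let $s\ge 1$, $1\le t\le k$ and $0\le c\le s-1$ be integers, and let $n$ be an integer with $n\ge c+t(s-c)$. For $i=1,\ldots,k$ let ${\cal A}_i\subset\binom{[n]}{s}$, and suppose that $\{{\cal A}_i\}_{i=1}^k$ contains no multicolor sunflower with $t$ petals and core size $c$. Let $m=\lfloor (n-c)/(s-c)\rfloor$. Then $$\sum_{i=1}^k|{\cal A}_i|\le\begin{cases} \dfrac{(t-1)k}{m}\dbinom{n}{s}, & \text{if } c+t(s-c)\le n\le c+k(s-c),\\[2mm] (t-1)\dbinom{n}{s}, & \text{if } n\ge c+k(s-c).\end{cases}$$
   Context: $[n]=\{1,\ldots,n\}$ and $\binom{[n]}{s}$ is the family of all $s$-element subsets of $[n]$. Given families ${\cal A}_1,\ldots,{\cal A}_k$ of subsets of $[n]$ and $t\le k$, a multicolor sunflower with $t$ petals and core size $c$ consists of $t$ distinct indices $i_1,\ldots,i_t\in[k]$ and sets $A_{i_j}\in{\cal A}_{i_j}$ ($j=1,\ldots,t$), together with a set $C$ with $|C|=c$, such that $A_{i_j}\cap A_{i_l}=C$ for all $j\neq l$ and $A_{i_j}\setminus C\neq\emptyset$ for all $j$. -}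

module Defs where

open import Data.Nat using (ℕ; zero; suc; _+_; _*_; _∸_; _<_; _/_; >-nonZero)
open import Data.Nat.Properties using (m<n⇒0<n∸m)
open import Data.Bool using (Bool; true; false)
open import Data.Fin using (Fin)
open import Data.Fin.Subset using (Subset; _∩_; _─_; ∣_∣; Nonempty)
open import Data.Vec using ([]; _∷_)
open import Data.List using (List; []; _∷_; _++_; map; filterᵇ; length; allFin)
open import Data.Nat.ListAction using (sum)
open import Data.Product using (Σ; _×_)
open import Function.Definitions using (Injective)
open import Relation.Binary.PropositionalEquality using (_≡_)

Family : ℕ → Set
Family n = Subset n → Bool

allSubsets : (n : ℕ) → List (Subset n)
allSubsets zero = [] ∷ []
allSubsets (suc n) = map (true ∷_) (allSubsets n) ++ map (false ∷_) (allSubsets n)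

card : ∀ {n} → Family n → ℕ
card {n} 𝒜 = length (filterᵇ 𝒜 (allSubsets n))

Uniform : ∀ {n} → ℕ → Family n → Set
Uniform {n} s 𝒜 = (S : Subset n) → 𝒜 S ≡ true → ∣ S ∣ ≡ s

totalSize : ∀ {n k} → (Fin k → Family n) → ℕ
totalSize {n} {k} 𝒜 = sum (map (λ i → card (𝒜 i)) (allFin k))

MulticolorSunflower : ∀ {n k} → (Fin k → Family n) → (t c : ℕ) → Set
MulticolorSunflower {n} {k} 𝒜 t c =
  Σ (Fin t → Fin k) λ ι → Injective _≡_ _≡_ ι ×
  Σ (Fin t → Subset n) λ A → Σ (Subset n) λ C →
    ((j : Fin t) → 𝒜 (ι j) (A j) ≡ true) ×
    (∣ C ∣ ≡ c) ×
    ((j l : Fin t) → (j ≡ l → Data.Empty.⊥) → A j ∩ A l ≡ C) ×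
    ((j : Fin t) → Nonempty (A j ─ C))
  where import Data.Empty

floorQuot : (n c s : ℕ) → c < s → ℕ
floorQuot n c s c<s = _/_ (n ∸ c) (s ∸ c) {{>-nonZero (m<n⇒0<n∸m c<s)}}

-- Double counting over labellings of [n]. A labelling marks c points as the core C, splits
-- m·(s − c) further points into blocks B₀, …, B_{m−1} of size s − c and leaves the rest unused.
-- For each labelling and each shift r < k, family i is offered the petal C ∪ B_{(r+i) mod k}
-- (nothing if (r+i) mod k ≥ m). Accepted offers of different families pairwise meet in C, so
-- sunflower-freeness allows at most t − 1 acceptances, i.e. at most (t − 1)·k·Ω in total, where
-- Ω counts the labellings. On the other hand each petal is a uniformly distributed s-set, so a
-- fixed block is accepted by family i in |𝒜ᵢ|·Ω/C(n,s) labellings, and every family meets every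
-- one of the m blocks in exactly one shift: m·Σ|𝒜ᵢ|·Ω/C(n,s) acceptances. The two cases take
-- m = ⌊(n − c)/(s − c)⌋ and m = k.

module Submission where

open import Defs
open import Data.Nat
  using (ℕ; zero; suc; _+_; _*_; _∸_; _≤_; _<_; z≤n; s≤s; z<s; pred; _≤?_; _<ᵇ_; _≡ᵇ_; _%_; NonZero; >-nonZero)
open import Data.Nat.Properties hiding (_≟_)
import Data.Nat.Properties as ℕ
open import Data.Nat.DivMod
  using (_/_; _mod_; %-distribˡ-+; m%n%n≡m%n; [m+n]%n≡m%n; m<n⇒m%n≡m; m/n*n≤m; /-monoˡ-≤; m*n/n≡m)
open import Data.Nat.Combinatorics using (_C_; nCk+nC[k+1]≡[n+1]C[k+1])
open import Data.Nat.Tactic.RingSolver using (solve-∀)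
import Data.Nat.ListAction as ListAction
open import Data.Nat.ListAction.Properties using (sum-++)
open import Data.Bool using (Bool; true; false; not; _∧_; if_then_else_; T)
open import Data.Unit using (tt)
open import Data.Fin using (Fin; zero; suc; toℕ)
open import Data.Fin.Properties as Fin using (toℕ-injective; toℕ-fromℕ<; toℕ<n; _≟_)
open import Data.Fin.Permutation using (Permutation; permutation; _⟨$⟩ʳ_; _⟨$⟩ˡ_; inverseˡ)
open import Data.Fin.Subset using (Subset; ∣_∣; _∩_; _─_; _⊆_; Nonempty)
open import Data.Fin.Subset.Properties using (∣p∣≤n; nonempty?; _∈?_; p⊆q⇒∣p∣≤∣q∣; x∈p∧x∉q⇒x∈p─q)
open import Data.Vec using (Vec; []; _∷_; map)
open import Data.Vec.Properties using (map-cong)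
open import Data.Vec.Functional using (updateAt)
open import Data.List as List using (List; []; _∷_; _++_; length; filterᵇ)
open import Data.List.Properties using (map-++; map-∘; map-tabulate)
open import Data.Product using (Σ; ∃-syntax; _×_; _,_)
open import Function using (_∘_; id)
open import Function.Definitions using (Injective)
open import Relation.Nullary using (¬_; yes; no; does; contradiction)
open import Relation.Nullary.Decidable using (dec-true; dec-false)
open import Relation.Binary.PropositionalEquality
open import Algebra.Properties.Semiring.Sum +-*-semiring
  using (sum; sum-syntax; sum-cong-≗; sum-replicate-zero; ∑-distrib-+; ∑-comm; *-distribˡ-sum; *-distribʳ-sum; ∑-permute)
import Algebra.Properties.CommutativeSemigroup as CommutativeSemigroupProperties
module +-CS = CommutativeSemigroupProperties +-commutativeSemigroup
module *-CS = CommutativeSemigroupProperties *-commutativeSemigroup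

𝟙 : Bool → ℕ
𝟙 false = 0
𝟙 true  = 1

guarded-cong : ∀ x {Y Z : ℕ} → (∀ {v} → x ≡ suc v → Y ≡ Z) → 𝟙 (0 <ᵇ x) * Y ≡ 𝟙 (0 <ᵇ x) * Z
guarded-cong zero    Y≡Z = refl
guarded-cong (suc v) Y≡Z = cong (1 *_) (Y≡Z refl)

sum-mono-≤ : ∀ {n} {f g : Fin n → ℕ} → (∀ i → f i ≤ g i) → sum f ≤ sum g
sum-mono-≤ {zero}  f≤g = z≤n
sum-mono-≤ {suc n} f≤g = +-mono-≤ (f≤g zero) (sum-mono-≤ (f≤g ∘ suc))

≤-sum : ∀ {n} (f : Fin n → ℕ) i → f i ≤ sum f
≤-sum f zero    = m≤m+n _ _
≤-sum f (suc i) = ≤-trans (≤-sum (f ∘ suc) i) (m≤n+m _ (f zero))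

sum-positive : ∀ {n} (f : Fin n → ℕ) → 0 < sum f → ∃[ i ] 0 < f i
sum-positive {suc n} f 0<∑ with f zero in eq
... | suc _ = zero , subst (0 <_) (sym eq) z<s
... | zero with sum-positive (f ∘ suc) 0<∑
...   | i , 0<fi = suc i , 0<fi

∑-𝟙<ᵇ : ∀ {k m} → m ≤ k → ∑[ j < k ] 𝟙 (toℕ j <ᵇ m) ≡ m
∑-𝟙<ᵇ {k}     {zero}  z≤n       = sum-replicate-zero k
∑-𝟙<ᵇ {suc k} {suc m} (s≤s m≤k) = cong suc (∑-𝟙<ᵇ m≤k)

sum-const : ∀ k x → ∑[ i < k ] x ≡ k * x
sum-const zero    x = refl
sum-const (suc k) x = cong (x +_) (sum-const k x)

sum-δ : ∀ {n} (f : Fin n → ℕ) j → ∑[ i < n ] (if does (i ≟ j) then f i else 0) ≡ f j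
sum-δ {suc n} f zero    = trans (cong (f zero +_) (sum-replicate-zero n)) (+-identityʳ (f zero))
sum-δ {suc n} f (suc j) = sum-δ (f ∘ suc) j

sum-tabulate : ∀ {k} (f : Fin k → ℕ) → ListAction.sum (List.tabulate f) ≡ sum f
sum-tabulate {zero}  f = refl
sum-tabulate {suc k} f = cong (f zero +_) (sum-tabulate (f ∘ suc))

totalSize≡∑card : ∀ {n k} (𝒜 : Fin k → Family n) → totalSize 𝒜 ≡ ∑[ i < k ] card (𝒜 i)
totalSize≡∑card 𝒜 = trans (cong ListAction.sum (map-tabulate id (card ∘ 𝒜))) (sum-tabulate (card ∘ 𝒜))

module _ {k : ℕ} .{{_ : NonZero k}} where

  private
    shift : ℕ → Fin k → Fin k
    shift a r = (a + toℕ r) mod k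

    [m+n%k]%k≡[m+n]%k : ∀ m n → (m + n % k) % k ≡ (m + n) % k
    [m+n%k]%k≡[m+n]%k m n = begin
      (m + n % k) % k           ≡⟨ %-distribˡ-+ m (n % k) k ⟩
      (m % k + n % k % k) % k   ≡⟨ cong (λ x → (m % k + x) % k) (m%n%n≡m%n n k) ⟩
      (m % k + n % k) % k       ≡⟨ %-distribˡ-+ m n k ⟨
      (m + n) % k               ∎
      where open ≡-Reasoning

    shift-shift : ∀ a b → a + b ≡ k → ∀ r → shift a (shift b r) ≡ r
    shift-shift a b a+b≡k r = toℕ-injective (begin
      toℕ ((a + toℕ ((b + toℕ r) mod k)) mod k)   ≡⟨ toℕ-fromℕ< _ ⟩
      (a + toℕ ((b + toℕ r) mod k)) % k           ≡⟨ cong (λ x → (a + x) % k) (toℕ-fromℕ< _) ⟩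
      (a + (b + toℕ r) % k) % k                   ≡⟨ [m+n%k]%k≡[m+n]%k a (b + toℕ r) ⟩
      (a + (b + toℕ r)) % k                       ≡⟨ cong (_% k) (+-assoc a b (toℕ r)) ⟨
      (a + b + toℕ r) % k                         ≡⟨ cong (λ x → (x + toℕ r) % k) a+b≡k ⟩
      (k + toℕ r) % k                             ≡⟨ cong (_% k) (+-comm k (toℕ r)) ⟩
      (toℕ r + k) % k                             ≡⟨ [m+n]%n≡m%n (toℕ r) k ⟩
      toℕ r % k                                   ≡⟨ m<n⇒m%n≡m (toℕ<n r) ⟩
      toℕ r                                       ∎)
      where open ≡-Reasoning

  rotation : Fin k → Permutation k k
  rotation i = permutation (shift (toℕ i)) (shift (k ∸ toℕ i))
    (shift-shift (toℕ i) (k ∸ toℕ i) (m+[n∸m]≡n i≤k))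
    (shift-shift (k ∸ toℕ i) (toℕ i) (m∸n+n≡m i≤k))
    where
    i≤k : toℕ i ≤ k
    i≤k = <⇒≤ (toℕ<n i)

  rotation-comm : ∀ i r → rotation i ⟨$⟩ʳ r ≡ rotation r ⟨$⟩ʳ i
  rotation-comm i r = cong (_mod k) (+-comm (toℕ i) (toℕ r))

  rotation-injective : ∀ r → Injective _≡_ _≡_ (rotation r ⟨$⟩ʳ_)
  rotation-injective r {i} {j} eq = begin
    i                                            ≡⟨ inverseˡ (rotation r) ⟨
    rotation r ⟨$⟩ˡ (rotation r ⟨$⟩ʳ i)           ≡⟨ cong (rotation r ⟨$⟩ˡ_) eq ⟩
    rotation r ⟨$⟩ˡ (rotation r ⟨$⟩ʳ j)           ≡⟨ inverseˡ (rotation r) ⟩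
    j                                            ∎
    where open ≡-Reasoning

  ∑-rotation : ∀ (g : Fin k → ℕ) i → ∑[ r < k ] g (rotation r ⟨$⟩ʳ i) ≡ sum g
  ∑-rotation g i = trans (sum-cong-≗ (λ r → cong g (rotation-comm r i))) (sym (∑-permute g (rotation i)))

map-∩ : ∀ {A : Set} {n} (P Q : A → Bool) (ω : Vec A n) → map P ω ∩ map Q ω ≡ map (λ x → P x ∧ Q x) ω
map-∩ P Q []      = refl
map-∩ P Q (x ∷ ω) = cong (P x ∧ Q x ∷_) (map-∩ P Q ω)

∣q∣<∣p∣⇒Nonempty[p─q] : ∀ {n} {p q : Subset n} → ∣ q ∣ < ∣ p ∣ → Nonempty (p ─ q)
∣q∣<∣p∣⇒Nonempty[p─q] {p = p} {q} ∣q∣<∣p∣ with nonempty? (p ─ q)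
... | yes p─q≠∅ = p─q≠∅
... | no  p─q=∅ = contradiction (p⊆q⇒∣p∣≤∣q∣ p⊆q) (<⇒≱ ∣q∣<∣p∣)
  where
  p⊆q : p ⊆ q
  p⊆q {x} x∈p with x ∈? q
  ... | yes x∈q = x∈q
  ... | no  x∉q = contradiction (x , x∈p∧x∉q⇒x∈p─q x∈p x∉q) p─q=∅

≤∑𝟙⇒injection : ∀ {k} (p : Fin k → Bool) t → t ≤ ∑[ i < k ] 𝟙 (p i) →
         Σ (Fin t → Fin k) λ ι → Injective _≡_ _≡_ ι × (∀ a → p (ι a) ≡ true)
≤∑𝟙⇒injection p zero _ = (λ ()) , (λ { {()} }) , (λ ())
≤∑𝟙⇒injection {suc k} p (suc t) t≤∑ with p zero in p₀
... | false with ≤∑𝟙⇒injection (p ∘ suc) (suc t) t≤∑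
...   | ι , ι-injective , p∘ι = suc ∘ ι , ι-injective ∘ Fin.suc-injective , p∘ι
≤∑𝟙⇒injection {suc k} p (suc t) (s≤s t≤∑) | true with ≤∑𝟙⇒injection (p ∘ suc) t t≤∑
...   | ι , ι-injective , p∘ι = ι′ , ι′-injective , p∘ι′
  where
  ι′ : Fin (suc t) → Fin (suc k)
  ι′ zero    = zero
  ι′ (suc a) = suc (ι a)
  ι′-injective : Injective _≡_ _≡_ ι′
  ι′-injective {zero}  {zero}  _  = refl
  ι′-injective {suc a} {suc b} eq = cong suc (ι-injective (Fin.suc-injective eq))
  p∘ι′ : ∀ a → p (ι′ a) ≡ true
  p∘ι′ zero    = p₀
  p∘ι′ (suc a) = p∘ι a

∣∷∣ : ∀ {n} b (S : Subset n) → ∣ b ∷ S ∣ ≡ 𝟙 b + ∣ S ∣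
∣∷∣ true  S = refl
∣∷∣ false S = refl

∑Sub : (n : ℕ) → (Subset n → ℕ) → ℕ
∑Sub zero    F = F []
∑Sub (suc n) F = ∑Sub n (F ∘ (true ∷_)) + ∑Sub n (F ∘ (false ∷_))

∑Sub-cong : ∀ n {F G : Subset n → ℕ} → (∀ S → F S ≡ G S) → ∑Sub n F ≡ ∑Sub n G
∑Sub-cong zero    F≗G = F≗G []
∑Sub-cong (suc n) F≗G = cong₂ _+_ (∑Sub-cong n (F≗G ∘ (true ∷_))) (∑Sub-cong n (F≗G ∘ (false ∷_)))

∑Sub-*ˡ : ∀ n c (F : Subset n → ℕ) → ∑Sub n (λ S → c * F S) ≡ c * ∑Sub n F
∑Sub-*ˡ zero    c F = refl
∑Sub-*ˡ (suc n) c F = trans (cong₂ _+_ (∑Sub-*ˡ n c _) (∑Sub-*ˡ n c _)) (sym (*-distribˡ-+ c _ _))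

∑Sub-zero : ∀ n → ∑Sub n (λ _ → 0) ≡ 0
∑Sub-zero zero    = refl
∑Sub-zero (suc n) = cong₂ _+_ (∑Sub-zero n) (∑Sub-zero n)

∑Sub-binomial : ∀ n s → ∑Sub n (λ S → 𝟙 (∣ S ∣ ≡ᵇ s)) ≡ n C s
∑Sub-binomial zero    zero    = refl
∑Sub-binomial zero    (suc s) = refl
∑Sub-binomial (suc n) zero    = cong₂ _+_ (∑Sub-zero n) (∑Sub-binomial n zero)
∑Sub-binomial (suc n) (suc s) =
  trans (cong₂ _+_ (∑Sub-binomial n s) (∑Sub-binomial n (suc s))) (nCk+nC[k+1]≡[n+1]C[k+1] n s)

∑Sub-allSubsets : ∀ n (F : Subset n → ℕ) → ListAction.sum (List.map F (allSubsets n)) ≡ ∑Sub n F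
∑Sub-allSubsets zero    F = +-identityʳ (F [])
∑Sub-allSubsets (suc n) F = begin
  ListAction.sum (List.map F (List.map (true ∷_) all ++ List.map (false ∷_) all))
    ≡⟨ cong ListAction.sum (map-++ F (List.map (true ∷_) all) _) ⟩
  ListAction.sum (List.map F (List.map (true ∷_) all) ++ List.map F (List.map (false ∷_) all))
    ≡⟨ sum-++ (List.map F (List.map (true ∷_) all)) _ ⟩
  ListAction.sum (List.map F (List.map (true ∷_) all)) + ListAction.sum (List.map F (List.map (false ∷_) all))
    ≡⟨ cong₂ (λ xs ys → ListAction.sum xs + ListAction.sum ys) (map-∘ all) (map-∘ all) ⟨
  ListAction.sum (List.map (F ∘ (true ∷_)) all) + ListAction.sum (List.map (F ∘ (false ∷_)) all)
    ≡⟨ cong₂ _+_ (∑Sub-allSubsets n _) (∑Sub-allSubsets n _) ⟩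
  ∑Sub (suc n) F ∎
  where
  open ≡-Reasoning
  all : List (Subset n)
  all = allSubsets n

length-filterᵇ : ∀ {A : Set} (p : A → Bool) xs → length (filterᵇ p xs) ≡ ListAction.sum (List.map (𝟙 ∘ p) xs)
length-filterᵇ p [] = refl
length-filterᵇ p (x ∷ xs) with p x
... | true  = cong suc (length-filterᵇ p xs)
... | false = length-filterᵇ p xs

card≡∑Sub : ∀ {n} (A : Family n) → card A ≡ ∑Sub n (𝟙 ∘ A)
card≡∑Sub {n} A = trans (length-filterᵇ A (allSubsets n)) (∑Sub-allSubsets n (𝟙 ∘ A))

∑Sub-uniform : ∀ {n s} {A : Family n} → Uniform s A → ∀ a →
               ∑Sub n (λ S → 𝟙 (∣ S ∣ ≡ᵇ a) * 𝟙 (A S)) ≡ 𝟙 (s ≡ᵇ a) * card A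
∑Sub-uniform {n} {s} {A} A-uniform a = begin
  ∑Sub n (λ S → 𝟙 (∣ S ∣ ≡ᵇ a) * 𝟙 (A S)) ≡⟨ ∑Sub-cong n size-is-s ⟩
  ∑Sub n (λ S → 𝟙 (s ≡ᵇ a) * 𝟙 (A S))     ≡⟨ ∑Sub-*ˡ n (𝟙 (s ≡ᵇ a)) (𝟙 ∘ A) ⟩
  𝟙 (s ≡ᵇ a) * ∑Sub n (𝟙 ∘ A)              ≡⟨ cong (𝟙 (s ≡ᵇ a) *_) (card≡∑Sub A) ⟨
  𝟙 (s ≡ᵇ a) * card A                      ∎
  where
  open ≡-Reasoning
  size-is-s : ∀ S → 𝟙 (∣ S ∣ ≡ᵇ a) * 𝟙 (A S) ≡ 𝟙 (s ≡ᵇ a) * 𝟙 (A S)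
  size-is-s S with A S in S∈A
  ... | true  = cong (λ x → 𝟙 (x ≡ᵇ a) * 1) (A-uniform S S∈A)
  ... | false = trans (*-zeroʳ (𝟙 (∣ S ∣ ≡ᵇ a))) (sym (*-zeroʳ (𝟙 (s ≡ᵇ a))))

mask : ∀ {L} → (Fin L → Bool) → (Fin L → ℕ) → Fin L → ℕ
mask P q ℓ = if P ℓ then q ℓ else 0

lower : ∀ {L} → (Fin L → ℕ) → Fin L → Fin L → ℕ
lower q ℓ = updateAt q ℓ pred

lower-cong : ∀ {L} {q q′ : Fin L → ℕ} → q ≗ q′ → ∀ ℓ → lower q ℓ ≗ lower q′ ℓ
lower-cong q≗q′ zero    zero    = cong pred (q≗q′ zero)
lower-cong q≗q′ zero    (suc x) = q≗q′ (suc x)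
lower-cong q≗q′ (suc ℓ) zero    = q≗q′ zero
lower-cong q≗q′ (suc ℓ) (suc x) = lower-cong (q≗q′ ∘ suc) ℓ x

mask-lower-inside : ∀ {L} P (q : Fin L → ℕ) ℓ → P ℓ ≡ true → mask P (lower q ℓ) ≗ lower (mask P q) ℓ
mask-lower-inside P q zero    Pℓ zero    rewrite Pℓ = refl
mask-lower-inside P q zero    Pℓ (suc x) = refl
mask-lower-inside P q (suc ℓ) Pℓ zero    = refl
mask-lower-inside P q (suc ℓ) Pℓ (suc x) = mask-lower-inside (P ∘ suc) (q ∘ suc) ℓ Pℓ x

mask-lower-outside : ∀ {L} P (q : Fin L → ℕ) ℓ → P ℓ ≡ false → mask P (lower q ℓ) ≗ mask P q
mask-lower-outside P q zero    Pℓ zero    rewrite Pℓ = refl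
mask-lower-outside P q zero    Pℓ (suc x) = refl
mask-lower-outside P q (suc ℓ) Pℓ zero    = refl
mask-lower-outside P q (suc ℓ) Pℓ (suc x) = mask-lower-outside (P ∘ suc) (q ∘ suc) ℓ Pℓ x

sum-mask-lower : ∀ {L} P (q : Fin L → ℕ) ℓ {v} → q ℓ ≡ suc v →
                 sum (mask P q) ≡ 𝟙 (P ℓ) + sum (mask P (lower q ℓ))
sum-mask-lower P q zero qℓ with P zero
... | true  rewrite qℓ = refl
... | false = refl
sum-mask-lower P q (suc ℓ) qℓ = trans
  (cong (mask P q zero +_) (sum-mask-lower (P ∘ suc) (q ∘ suc) ℓ qℓ))
  (+-CS.x∙yz≈y∙xz (mask P q zero) (𝟙 (P (suc ℓ))) _)

sum-lower : ∀ {L} (q : Fin L → ℕ) ℓ {v} → q ℓ ≡ suc v → sum q ≡ suc (sum (lower q ℓ))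
sum-lower = sum-mask-lower (λ _ → true)

sum-lower-≡ : ∀ {L} (q : Fin L → ℕ) ℓ {v n} → q ℓ ≡ suc v → sum q ≡ suc n → sum (lower q ℓ) ≡ n
sum-lower-≡ q ℓ qℓ ∑q≡1+n = suc-injective (trans (sym (sum-lower q ℓ qℓ)) ∑q≡1+n)

sum-mask-split : ∀ {L} P (q : Fin L → ℕ) → sum q ≡ sum (mask P q) + sum (mask (not ∘ P) q)
sum-mask-split P q = trans (sum-cong-≗ split) (∑-distrib-+ (mask P q) (mask (not ∘ P) q))
  where
  split : ∀ ℓ → q ℓ ≡ mask P q ℓ + mask (not ∘ P) q ℓ
  split ℓ with P ℓ
  ... | true  = sym (+-identityʳ (q ℓ))
  ... | false = refl

∑Lab : ∀ {L} (n : ℕ) → (Fin L → ℕ) → (Vec (Fin L) n → ℕ) → ℕ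
∑Lab         zero    q F = 𝟙 (sum q ≡ᵇ 0) * F []
∑Lab {L = L} (suc n) q F = ∑[ ℓ < L ] (𝟙 (0 <ᵇ q ℓ) * ∑Lab n (lower q ℓ) (F ∘ (ℓ ∷_)))

module _ {L : ℕ} where

  ∑Lab-cong-profile : ∀ n {q q′ : Fin L → ℕ} (F : Vec (Fin L) n → ℕ) → q ≗ q′ → ∑Lab n q F ≡ ∑Lab n q′ F
  ∑Lab-cong-profile zero    F q≗q′ = cong (λ x → 𝟙 (x ≡ᵇ 0) * F []) (sum-cong-≗ q≗q′)
  ∑Lab-cong-profile (suc n) F q≗q′ = sum-cong-≗ λ ℓ →
    cong₂ (λ x y → 𝟙 (0 <ᵇ x) * y) (q≗q′ ℓ) (∑Lab-cong-profile n (F ∘ (ℓ ∷_)) (lower-cong q≗q′ ℓ))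

  ∑Lab-+ : ∀ n (q : Fin L → ℕ) (F G : Vec (Fin L) n → ℕ) →
           ∑Lab n q (λ ω → F ω + G ω) ≡ ∑Lab n q F + ∑Lab n q G
  ∑Lab-+ zero    q F G = *-distribˡ-+ (𝟙 (sum q ≡ᵇ 0)) (F []) (G [])
  ∑Lab-+ (suc n) q F G = trans
    (sum-cong-≗ λ ℓ → trans (cong (𝟙 (0 <ᵇ q ℓ) *_) (∑Lab-+ n (lower q ℓ) (F ∘ (ℓ ∷_)) (G ∘ (ℓ ∷_))))
                               (*-distribˡ-+ (𝟙 (0 <ᵇ q ℓ)) _ _))
    (∑-distrib-+ (λ ℓ → 𝟙 (0 <ᵇ q ℓ) * ∑Lab n (lower q ℓ) (F ∘ (ℓ ∷_)))
                 (λ ℓ → 𝟙 (0 <ᵇ q ℓ) * ∑Lab n (lower q ℓ) (G ∘ (ℓ ∷_))))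

  ∑Lab-*ˡ : ∀ n (q : Fin L → ℕ) c (F : Vec (Fin L) n → ℕ) → ∑Lab n q (λ ω → c * F ω) ≡ c * ∑Lab n q F
  ∑Lab-*ˡ zero    q c F = *-CS.x∙yz≈y∙xz (𝟙 (sum q ≡ᵇ 0)) c (F [])
  ∑Lab-*ˡ (suc n) q c F = trans
    (sum-cong-≗ λ ℓ → trans (cong (𝟙 (0 <ᵇ q ℓ) *_) (∑Lab-*ˡ n (lower q ℓ) c (F ∘ (ℓ ∷_))))
                               (*-CS.x∙yz≈y∙xz (𝟙 (0 <ᵇ q ℓ)) c _))
    (sym (*-distribˡ-sum c (λ ℓ → 𝟙 (0 <ᵇ q ℓ) * ∑Lab n (lower q ℓ) (F ∘ (ℓ ∷_)))))

  ∑Lab-zero : ∀ n (q : Fin L → ℕ) → ∑Lab n q (λ _ → 0) ≡ 0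
  ∑Lab-zero n q = ∑Lab-*ˡ n q 0 (λ _ → 0)

  ∑Lab-sum : ∀ n (q : Fin L → ℕ) {k} (F : Fin k → Vec (Fin L) n → ℕ) →
             ∑Lab n q (λ ω → ∑[ i < k ] F i ω) ≡ ∑[ i < k ] ∑Lab n q (F i)
  ∑Lab-sum n q {zero}  F = ∑Lab-zero n q
  ∑Lab-sum n q {suc k} F = trans (∑Lab-+ n q (F zero) _) (cong (∑Lab n q (F zero) +_) (∑Lab-sum n q (F ∘ suc)))

HasProfile : ∀ {L n} → (Fin L → ℕ) → Vec (Fin L) n → Set
HasProfile q ω = ∀ P → ∣ map P ω ∣ ≡ sum (mask P q)

module _ {L : ℕ} where

  hasProfile-[] : {q : Fin L → ℕ} → sum q ≡ 0 → HasProfile q []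
  hasProfile-[] {q} ∑q≡0 P = sym (m+n≡0⇒m≡0 _ (trans (sym (sum-mask-split P q)) ∑q≡0))

  hasProfile-∷ : ∀ {n} {q : Fin L → ℕ} {ℓ v} {ω : Vec (Fin L) n} → q ℓ ≡ suc v →
                 HasProfile (lower q ℓ) ω → HasProfile q (ℓ ∷ ω)
  hasProfile-∷ {q = q} {ℓ} {ω = ω} qℓ ω-profile P = begin
    ∣ P ℓ ∷ map P ω ∣                      ≡⟨ ∣∷∣ (P ℓ) (map P ω) ⟩
    𝟙 (P ℓ) + ∣ map P ω ∣                  ≡⟨ cong (𝟙 (P ℓ) +_) (ω-profile P) ⟩
    𝟙 (P ℓ) + sum (mask P (lower q ℓ))     ≡⟨ sum-mask-lower P q ℓ qℓ ⟨
    sum (mask P q)                         ∎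
    where open ≡-Reasoning

  ∑Lab-mono : ∀ n (q : Fin L → ℕ) {F G : Vec (Fin L) n → ℕ} →
              (∀ ω → HasProfile q ω → F ω ≤ G ω) → ∑Lab n q F ≤ ∑Lab n q G
  ∑Lab-mono zero q F≤G with sum q in ∑q
  ... | zero  = +-monoˡ-≤ 0 (F≤G [] (hasProfile-[] ∑q))
  ... | suc _ = z≤n
  ∑Lab-mono (suc n) q {F} {G} F≤G = sum-mono-≤ first-label
    where
    first-label : ∀ ℓ → 𝟙 (0 <ᵇ q ℓ) * ∑Lab n (lower q ℓ) (F ∘ (ℓ ∷_))
                      ≤ 𝟙 (0 <ᵇ q ℓ) * ∑Lab n (lower q ℓ) (G ∘ (ℓ ∷_))
    first-label ℓ with q ℓ in qℓ
    ... | zero  = z≤n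
    ... | suc _ = +-monoˡ-≤ 0 (∑Lab-mono n (lower q ℓ) λ ω ω-profile →
                                F≤G (ℓ ∷ ω) (hasProfile-∷ {ω = ω} qℓ ω-profile))

  ∑Lab-positive : ∀ n (q : Fin L → ℕ) → sum q ≡ n → 0 < ∑Lab n q (λ _ → 1)
  ∑Lab-positive zero    q ∑q≡0 rewrite ∑q≡0 = z<s
  ∑Lab-positive (suc n) q ∑q≡1+n with sum-positive q (subst (0 <_) (sym ∑q≡1+n) z<s)
  ... | ℓ , 0<qℓ = <-≤-trans (first-label 0<qℓ) (≤-sum _ ℓ)
    where
    first-label : 0 < q ℓ → 0 < 𝟙 (0 <ᵇ q ℓ) * ∑Lab n (lower q ℓ) (λ _ → 1)
    first-label 0<qℓ with q ℓ in qℓ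
    ... | suc _ = subst (0 <_) (sym (+-identityʳ _))
      (∑Lab-positive n (lower q ℓ) (sum-lower-≡ q ℓ qℓ ∑q≡1+n))

  multinomial : (Fin L → ℕ) → ℕ
  multinomial q = ∑Lab (sum q) q (λ _ → 1)

  ∑Lab-1 : ∀ {n} {q : Fin L → ℕ} → sum q ≡ n → ∑Lab n q (λ _ → 1) ≡ multinomial q
  ∑Lab-1 {q = q} ∑q≡n = cong (λ m → ∑Lab m q (λ _ → 1)) (sym ∑q≡n)

  multinomial-cong : {q q′ : Fin L → ℕ} → q ≗ q′ → multinomial q ≡ multinomial q′
  multinomial-cong {q} {q′} q≗q′ =
    trans (sym (∑Lab-1 {q = q} (sum-cong-≗ q≗q′))) (∑Lab-cong-profile (sum q′) (λ _ → 1) q≗q′)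

  multinomial-empty : {q : Fin L → ℕ} → sum q ≡ 0 → multinomial q ≡ 1
  multinomial-empty {q} ∑q≡0 rewrite ∑q≡0 | ∑q≡0 = refl

  multinomial-rec : ∀ (q : Fin L → ℕ) {a} → sum q ≡ suc a →
                    ∑[ ℓ < L ] (𝟙 (0 <ᵇ q ℓ) * multinomial (lower q ℓ)) ≡ multinomial q
  multinomial-rec q ∑q≡1+a = trans
    (sum-cong-≗ λ ℓ → guarded-cong (q ℓ) λ qℓ → sym (∑Lab-1 (sum-lower-≡ q ℓ qℓ ∑q≡1+a)))
    (∑Lab-1 ∑q≡1+a)

  multinomial-step : ∀ (q : Fin L → ℕ) Y → (sum q ≡ 0 → Y ≡ 0) →
                     ∑[ ℓ < L ] (𝟙 (0 <ᵇ q ℓ) * multinomial (lower q ℓ) * Y) ≡ multinomial q * Y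
  multinomial-step q Y Y≡0 = by-size (sum q) refl
    where
    by-size : ∀ m → sum q ≡ m → ∑[ ℓ < L ] (𝟙 (0 <ᵇ q ℓ) * multinomial (lower q ℓ) * Y) ≡ multinomial q * Y
    by-size zero    ∑q≡0 rewrite Y≡0 ∑q≡0 =
      trans (sum-cong-≗ (λ ℓ → *-zeroʳ (𝟙 (0 <ᵇ q ℓ) * multinomial (lower q ℓ))))
            (trans (sum-replicate-zero L) (sym (*-zeroʳ (multinomial q))))
    by-size (suc a) ∑q≡1+a = trans (sym (*-distribʳ-sum Y (λ ℓ → 𝟙 (0 <ᵇ q ℓ) * multinomial (lower q ℓ))))
                                   (cong (_* Y) (multinomial-rec q ∑q≡1+a))

module Preimage {L : ℕ} (P : Fin L → Bool) where

  P̄ : Fin L → Bool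
  P̄ = not ∘ P

  -- A q-labelling amounts to its P-preimage S together with a labelling of S by the labels in P
  -- and one of the complement of S by the other labels.
  ∑Lab-preimage : ∀ n (q : Fin L → ℕ) (A : Subset n → ℕ) → sum q ≡ n →
    ∑Lab n q (A ∘ map P) ≡
      multinomial (mask P q) * multinomial (mask P̄ q) * ∑Sub n (λ S → 𝟙 (∣ S ∣ ≡ᵇ sum (mask P q)) * A S)
  ∑Lab-preimage zero q A ∑q≡0 = begin
    𝟙 (sum q ≡ᵇ 0) * A []
      ≡⟨ cong (λ x → 𝟙 (x ≡ᵇ 0) * A []) ∑q≡0 ⟩
    1 * A []
      ≡⟨ +-identityʳ (1 * A []) ⟨
    1 * 1 * (𝟙 (0 ≡ᵇ 0) * A [])
      ≡⟨ cong₂ (λ x y → x * y * (𝟙 (0 ≡ᵇ 0) * A []))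
               (multinomial-empty {q = mask P q} ∑P≡0) (multinomial-empty {q = mask P̄ q} ∑P̄≡0) ⟨
    multinomial (mask P q) * multinomial (mask P̄ q) * (𝟙 (0 ≡ᵇ 0) * A [])
      ≡⟨ cong (λ x → multinomial (mask P q) * multinomial (mask P̄ q) * (𝟙 (0 ≡ᵇ x) * A [])) ∑P≡0 ⟨
    multinomial (mask P q) * multinomial (mask P̄ q) * (𝟙 (0 ≡ᵇ sum (mask P q)) * A []) ∎
    where
    open ≡-Reasoning
    ∑P≡0 : sum (mask P q) ≡ 0
    ∑P≡0 = m+n≡0⇒m≡0 _ (trans (sym (sum-mask-split P q)) ∑q≡0)
    ∑P̄≡0 : sum (mask P̄ q) ≡ 0
    ∑P̄≡0 = m+n≡0⇒n≡0 (sum (mask P q)) (trans (sym (sum-mask-split P q)) ∑q≡0)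
  ∑Lab-preimage (suc n) q A ∑q≡1+n = begin
    ∑[ ℓ < L ] starting-with ℓ
      ≡⟨ sum-cong-≗ first-label ⟩
    ∑[ ℓ < L ] (U ℓ * (M̄ * T₁) + Ū ℓ * (M * T₀))
      ≡⟨ ∑-distrib-+ (λ ℓ → U ℓ * (M̄ * T₁)) (λ ℓ → Ū ℓ * (M * T₀)) ⟩
    ∑[ ℓ < L ] (U ℓ * (M̄ * T₁)) + ∑[ ℓ < L ] (Ū ℓ * (M * T₀))
      ≡⟨ cong₂ _+_ (multinomial-step qP (M̄ * T₁) M̄T₁-vanishes) (multinomial-step qP̄ (M * T₀) MT₀-vanishes) ⟩
    M * (M̄ * T₁) + M̄ * (M * T₀)
      ≡⟨ regroup M M̄ T₁ T₀ ⟩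
    M * M̄ * (T₁ + T₀) ∎
    where
    open ≡-Reasoning
    qP qP̄ : Fin L → ℕ
    qP = mask P q
    qP̄ = mask P̄ q
    M M̄ a T₁ T₀ : ℕ
    M  = multinomial qP
    M̄  = multinomial qP̄
    a  = sum qP
    T₁ = ∑Sub n (λ S → 𝟙 (suc ∣ S ∣ ≡ᵇ a) * A (true ∷ S))
    T₀ = ∑Sub n (λ S → 𝟙 (∣ S ∣ ≡ᵇ a) * A (false ∷ S))
    starting-with U Ū : Fin L → ℕ
    starting-with ℓ = 𝟙 (0 <ᵇ q ℓ) * ∑Lab n (lower q ℓ) (A ∘ (P ℓ ∷_) ∘ map P)
    U ℓ = 𝟙 (0 <ᵇ qP ℓ) * multinomial (lower qP ℓ)
    Ū ℓ = 𝟙 (0 <ᵇ qP̄ ℓ) * multinomial (lower qP̄ ℓ)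

    regroup : ∀ x y z w → x * (y * z) + y * (x * w) ≡ x * y * (z + w)
    regroup = solve-∀

    M̄T₁-vanishes : a ≡ 0 → M̄ * T₁ ≡ 0
    M̄T₁-vanishes a≡0 = trans (cong (M̄ *_) T₁≡0) (*-zeroʳ M̄)
      where
      T₁≡0 : T₁ ≡ 0
      T₁≡0 = trans (∑Sub-cong n λ S → cong (λ x → 𝟙 (suc ∣ S ∣ ≡ᵇ x) * A (true ∷ S)) a≡0) (∑Sub-zero n)

    MT₀-vanishes : sum qP̄ ≡ 0 → M * T₀ ≡ 0
    MT₀-vanishes ∑P̄≡0 = trans (cong (M *_) T₀≡0) (*-zeroʳ M)
      where
      a≡1+n : a ≡ suc n
      a≡1+n = trans (sym (+-identityʳ a)) (trans (cong (a +_) (sym ∑P̄≡0)) (trans (sym (sum-mask-split P q)) ∑q≡1+n))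
      T₀≡0 : T₀ ≡ 0
      T₀≡0 = trans (∑Sub-cong n λ S → cong (λ b → 𝟙 b * A (false ∷ S))
                     (trans (cong (∣ S ∣ ≡ᵇ_) a≡1+n) (dec-false (∣ S ∣ ℕ.≟ suc n) (<⇒≢ (s≤s (∣p∣≤n S))))))
                   (∑Sub-zero n)

    inside : ∀ ℓ → P ℓ ≡ true → starting-with ℓ ≡ U ℓ * (M̄ * T₁)
    inside ℓ Pℓ = begin
      starting-with ℓ
        ≡⟨ guarded-cong (q ℓ) remaining ⟩
      𝟙 (0 <ᵇ q ℓ) * (multinomial (lower qP ℓ) * M̄ * T₁)
        ≡⟨ cong (λ x → 𝟙 (0 <ᵇ x) * (multinomial (lower qP ℓ) * M̄ * T₁)) (sym qPℓ≡qℓ) ⟩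
      𝟙 (0 <ᵇ qP ℓ) * (multinomial (lower qP ℓ) * M̄ * T₁)
        ≡⟨ cong (𝟙 (0 <ᵇ qP ℓ) *_) (*-assoc (multinomial (lower qP ℓ)) M̄ T₁) ⟩
      𝟙 (0 <ᵇ qP ℓ) * (multinomial (lower qP ℓ) * (M̄ * T₁))
        ≡⟨ *-assoc (𝟙 (0 <ᵇ qP ℓ)) (multinomial (lower qP ℓ)) (M̄ * T₁) ⟨
      U ℓ * (M̄ * T₁) ∎
      where
      qPℓ≡qℓ : qP ℓ ≡ q ℓ
      qPℓ≡qℓ = cong (λ b → if b then q ℓ else 0) Pℓ
      remaining : ∀ {v} → q ℓ ≡ suc v →
                  ∑Lab n (lower q ℓ) (A ∘ (P ℓ ∷_) ∘ map P) ≡ multinomial (lower qP ℓ) * M̄ * T₁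
      remaining qℓ = trans (∑Lab-preimage n (lower q ℓ) (A ∘ (P ℓ ∷_)) (sum-lower-≡ q ℓ qℓ ∑q≡1+n)) (cong₂ _*_
        (cong₂ _*_ (multinomial-cong (mask-lower-inside P q ℓ Pℓ))
                   (multinomial-cong (mask-lower-outside P̄ q ℓ (cong not Pℓ))))
        (∑Sub-cong n λ S → cong₂ (λ x b → 𝟙 (suc ∣ S ∣ ≡ᵇ x) * A (b ∷ S)) a-drops Pℓ))
        where
        a-drops : suc (sum (mask P (lower q ℓ))) ≡ a
        a-drops = trans (cong suc (sum-cong-≗ (mask-lower-inside P q ℓ Pℓ)))
                        (sym (sum-lower qP ℓ (trans qPℓ≡qℓ qℓ)))

    outside : ∀ ℓ → P ℓ ≡ false → starting-with ℓ ≡ Ū ℓ * (M * T₀)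
    outside ℓ Pℓ = begin
      starting-with ℓ
        ≡⟨ guarded-cong (q ℓ) remaining ⟩
      𝟙 (0 <ᵇ q ℓ) * (M * multinomial (lower qP̄ ℓ) * T₀)
        ≡⟨ cong (λ x → 𝟙 (0 <ᵇ x) * (M * multinomial (lower qP̄ ℓ) * T₀)) (sym qP̄ℓ≡qℓ) ⟩
      𝟙 (0 <ᵇ qP̄ ℓ) * (M * multinomial (lower qP̄ ℓ) * T₀)
        ≡⟨ swap (𝟙 (0 <ᵇ qP̄ ℓ)) M (multinomial (lower qP̄ ℓ)) T₀ ⟩
      Ū ℓ * (M * T₀) ∎
      where
      swap : ∀ x y z w → x * (y * z * w) ≡ x * z * (y * w)
      swap = solve-∀
      qP̄ℓ≡qℓ : qP̄ ℓ ≡ q ℓ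
      qP̄ℓ≡qℓ = cong (λ b → if not b then q ℓ else 0) Pℓ
      remaining : ∀ {v} → q ℓ ≡ suc v →
                  ∑Lab n (lower q ℓ) (A ∘ (P ℓ ∷_) ∘ map P) ≡ M * multinomial (lower qP̄ ℓ) * T₀
      remaining qℓ = trans (∑Lab-preimage n (lower q ℓ) (A ∘ (P ℓ ∷_)) (sum-lower-≡ q ℓ qℓ ∑q≡1+n)) (cong₂ _*_
        (cong₂ _*_ (multinomial-cong (mask-lower-outside P q ℓ Pℓ))
                   (multinomial-cong (mask-lower-inside P̄ q ℓ (cong not Pℓ))))
        (∑Sub-cong n λ S → cong₂ (λ x b → 𝟙 (∣ S ∣ ≡ᵇ x) * A (b ∷ S))
                                 (sum-cong-≗ (mask-lower-outside P q ℓ Pℓ)) Pℓ))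

    first-label : ∀ ℓ → starting-with ℓ ≡ U ℓ * (M̄ * T₁) + Ū ℓ * (M * T₀)
    first-label ℓ = by-side (P ℓ) refl
      where
      by-side : ∀ b → P ℓ ≡ b → starting-with ℓ ≡ U ℓ * (M̄ * T₁) + Ū ℓ * (M * T₀)
      by-side true  Pℓ = trans (inside ℓ Pℓ) (sym (trans
        (cong (λ b → U ℓ * (M̄ * T₁) + 𝟙 (0 <ᵇ (if not b then q ℓ else 0)) * multinomial (lower qP̄ ℓ) * (M * T₀))
              Pℓ)
        (+-identityʳ _)))
      by-side false Pℓ = trans (outside ℓ Pℓ) (sym
        (cong (λ b → 𝟙 (0 <ᵇ (if b then q ℓ else 0)) * multinomial (lower qP ℓ) * (M̄ * T₁) + Ū ℓ * (M * T₀)) Pℓ))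

open Preimage using (∑Lab-preimage)

∑Lab-preimage-uniform : ∀ {L n s} (P : Fin L → Bool) (q : Fin L → ℕ) {A : Family n} → Uniform s A → sum q ≡ n →
  ∑Lab n q (λ ω → 𝟙 (A (map P ω))) * (n C s) ≡ 𝟙 (s ≡ᵇ sum (mask P q)) * card A * ∑Lab n q (λ _ → 1)
∑Lab-preimage-uniform {n = n} {s} P q {A} A-uniform ∑q≡n = begin
  ∑Lab n q (λ ω → 𝟙 (A (map P ω))) * (n C s)
    ≡⟨ cong (_* (n C s)) (∑Lab-preimage P n q (𝟙 ∘ A) ∑q≡n) ⟩
  K * ∑Sub n (λ S → 𝟙 (∣ S ∣ ≡ᵇ a) * 𝟙 (A S)) * (n C s)
    ≡⟨ cong (λ x → K * x * (n C s)) (∑Sub-uniform A-uniform a) ⟩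
  K * (𝟙 (s ≡ᵇ a) * card A) * (n C s)
    ≡⟨ by-size-match (s ≡ᵇ a) refl ⟩
  𝟙 (s ≡ᵇ a) * card A * (K * (n C a))
    ≡⟨ cong (λ x → 𝟙 (s ≡ᵇ a) * card A * (K * x)) (∑Sub-binomial n a) ⟨
  𝟙 (s ≡ᵇ a) * card A * (K * ∑Sub n (λ S → 𝟙 (∣ S ∣ ≡ᵇ a)))
    ≡⟨ cong (λ x → 𝟙 (s ≡ᵇ a) * card A * (K * x)) (∑Sub-cong n λ S → *-identityʳ (𝟙 (∣ S ∣ ≡ᵇ a))) ⟨
  𝟙 (s ≡ᵇ a) * card A * (K * ∑Sub n (λ S → 𝟙 (∣ S ∣ ≡ᵇ a) * 1))
    ≡⟨ cong (𝟙 (s ≡ᵇ a) * card A *_) (∑Lab-preimage P n q (λ _ → 1) ∑q≡n) ⟨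
  𝟙 (s ≡ᵇ a) * card A * ∑Lab n q (λ _ → 1) ∎
  where
  open ≡-Reasoning
  a K : ℕ
  a = sum (mask P q)
  K = multinomial (mask P q) * multinomial (mask (not ∘ P) q)
  by-size-match : ∀ b → (s ≡ᵇ a) ≡ b → K * (𝟙 b * card A) * (n C s) ≡ 𝟙 b * card A * (K * (n C a))
  by-size-match true  s≡ᵇa rewrite ≡ᵇ⇒≡ s a (subst T (sym s≡ᵇa) tt) = rearrange K (card A) (n C a)
    where
    rearrange : ∀ x y z → x * (1 * y) * z ≡ 1 * y * (x * z)
    rearrange = solve-∀
  by-size-match false _ = cong (_* (n C s)) (*-zeroʳ K)

module Construction {s k c n m : ℕ} (c<s : c < s) (m≤k : m ≤ k) (room : c + m * (s ∸ c) ≤ n) where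

  -- Label 0 marks unused points, label 1 the core and label 2 + j the block j, which has s − c
  -- points if j < m and is empty otherwise: the petal of an empty block has size c < s and so
  -- lies in no s-uniform family.
  profile : Fin (suc (suc k)) → ℕ
  profile zero          = n ∸ (c + m * (s ∸ c))
  profile (suc zero)    = c
  profile (suc (suc j)) = 𝟙 (toℕ j <ᵇ m) * (s ∸ c)

  isCore : Fin (suc (suc k)) → Bool
  isCore zero          = false
  isCore (suc zero)    = true
  isCore (suc (suc _)) = false

  isPetal : Fin k → Fin (suc (suc k)) → Bool
  isPetal j zero          = false
  isPetal j (suc zero)    = true
  isPetal j (suc (suc i)) = does (i ≟ j)

  sum-profile : sum profile ≡ n
  sum-profile = begin
    n ∸ (c + m * (s ∸ c)) + (c + ∑[ j < k ] (𝟙 (toℕ j <ᵇ m) * (s ∸ c)))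
      ≡⟨ cong (λ x → n ∸ (c + m * (s ∸ c)) + (c + x))
              (sym (*-distribʳ-sum {n = k} (s ∸ c) (λ j → 𝟙 (toℕ j <ᵇ m)))) ⟩
    n ∸ (c + m * (s ∸ c)) + (c + ∑[ j < k ] 𝟙 (toℕ j <ᵇ m) * (s ∸ c))
      ≡⟨ cong (λ x → n ∸ (c + m * (s ∸ c)) + (c + x * (s ∸ c))) (∑-𝟙<ᵇ m≤k) ⟩
    n ∸ (c + m * (s ∸ c)) + (c + m * (s ∸ c))
      ≡⟨ m∸n+n≡m room ⟩
    n ∎
    where open ≡-Reasoning

  sum-core : sum (mask isCore profile) ≡ c
  sum-core = trans (cong (c +_) (sum-replicate-zero k)) (+-identityʳ c)

  sum-petal : ∀ j → sum (mask (isPetal j) profile) ≡ c + 𝟙 (toℕ j <ᵇ m) * (s ∸ c)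
  sum-petal j = cong (c +_) (sum-δ {k} (λ i → profile (suc (suc i))) j)

  s≡ᵇpetal-size : ∀ b → (s ≡ᵇ c + 𝟙 b * (s ∸ c)) ≡ b
  s≡ᵇpetal-size true  = dec-true (s ℕ.≟ _) (sym (trans (cong (c +_) (*-identityˡ (s ∸ c))) (m+[n∸m]≡n (<⇒≤ c<s))))
  s≡ᵇpetal-size false = dec-false (s ℕ.≟ _) (>⇒≢ (subst (_< s) (sym (+-identityʳ c)) c<s))

  petals-∧ : ∀ {j l} → j ≢ l → ∀ x → isPetal j x ∧ isPetal l x ≡ isCore x
  petals-∧ j≢l zero          = refl
  petals-∧ j≢l (suc zero)    = refl
  petals-∧ {j} {l} j≢l (suc (suc i)) with i ≟ j | i ≟ l
  ... | yes refl | yes refl = contradiction refl j≢l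
  ... | yes _    | no _     = refl
  ... | no _     | _        = refl

  petal : Fin k → Vec (Fin (suc (suc k))) n → Subset n
  petal j ω = map (isPetal j) ω

  core : Vec (Fin (suc (suc k))) n → Subset n
  core ω = map isCore ω

  module Counting .{{_ : NonZero k}} {t : ℕ} (𝒜 : Fin k → Family n) (uniform : ∀ i → Uniform s (𝒜 i)) where

    hits : Vec (Fin (suc (suc k))) n → Fin k → Fin k → Bool
    hits ω r i = 𝒜 i (petal (rotation r ⟨$⟩ʳ i) ω)

    sunflower : ∀ {ω} → HasProfile profile ω → ∀ r (ι : Fin t → Fin k) → Injective _≡_ _≡_ ι →
                (∀ a → hits ω r (ι a) ≡ true) → MulticolorSunflower 𝒜 t c
    sunflower {ω} ω-profile r ι ι-injective ι-hits =
      ι , ι-injective , (λ a → petal (block a) ω) , core ω , ι-hits , ∣core∣≡c ,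
      (λ a b a≢b → trans (map-∩ (isPetal (block a)) (isPetal (block b)) ω)
                         (map-cong (petals-∧ (a≢b ∘ ι-injective ∘ rotation-injective r)) ω)) ,
      (λ a → ∣q∣<∣p∣⇒Nonempty[p─q] (subst₂ _<_ (sym ∣core∣≡c) (sym (uniform (ι a) _ (ι-hits a))) c<s))
      where
      block : Fin t → Fin k
      block a = rotation r ⟨$⟩ʳ ι a
      ∣core∣≡c : ∣ core ω ∣ ≡ c
      ∣core∣≡c = trans (ω-profile isCore) sum-core

    few-hits : ¬ MulticolorSunflower 𝒜 t c → ∀ {ω} → HasProfile profile ω → ∀ r →
               ∑[ i < k ] 𝟙 (hits ω r i) ≤ t ∸ 1
    few-hits no-sunflower {ω} ω-profile r with t ≤? ∑[ i < k ] 𝟙 (hits ω r i)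
    ... | yes t≤∑ with ≤∑𝟙⇒injection (hits ω r) t t≤∑
    ...   | ι , ι-injective , ι-hits = contradiction (sunflower ω-profile r ι ι-injective ι-hits) no-sunflower
    few-hits no-sunflower {ω} ω-profile r | no t≰∑ = suc[m]≤n⇒m≤pred[n] (≰⇒> t≰∑)

    Ω : ℕ
    Ω = ∑Lab n profile (λ _ → 1)

    hitCount : Vec (Fin (suc (suc k))) n → ℕ
    hitCount ω = ∑[ r < k ] ∑[ i < k ] 𝟙 (hits ω r i)

    ∑Lab-hitCount-≤ : ¬ MulticolorSunflower 𝒜 t c → ∑Lab n profile hitCount ≤ k * (t ∸ 1) * Ω
    ∑Lab-hitCount-≤ no-sunflower = begin
      ∑Lab n profile hitCount                   ≤⟨ ∑Lab-mono n profile hitCount-≤ ⟩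
      ∑Lab n profile (λ _ → k * (t ∸ 1) * 1)    ≡⟨ ∑Lab-*ˡ n profile (k * (t ∸ 1)) (λ _ → 1) ⟩
      k * (t ∸ 1) * Ω                           ∎
      where
      open ≤-Reasoning
      hitCount-≤ : ∀ ω → HasProfile profile ω → hitCount ω ≤ k * (t ∸ 1) * 1
      hitCount-≤ ω ω-profile = begin
        hitCount ω             ≤⟨ sum-mono-≤ (few-hits no-sunflower ω-profile) ⟩
        ∑[ r < k ] (t ∸ 1)     ≡⟨ sum-const k (t ∸ 1) ⟩
        k * (t ∸ 1)            ≡⟨ *-identityʳ (k * (t ∸ 1)) ⟨
        k * (t ∸ 1) * 1        ∎

    ∑Lab-hits : ∀ i j →
                ∑Lab n profile (λ ω → 𝟙 (𝒜 i (petal j ω))) * (n C s) ≡ 𝟙 (toℕ j <ᵇ m) * (card (𝒜 i) * Ω)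
    ∑Lab-hits i j = begin
      ∑Lab n profile (λ ω → 𝟙 (𝒜 i (petal j ω))) * (n C s)
        ≡⟨ ∑Lab-preimage-uniform (isPetal j) profile (uniform i) sum-profile ⟩
      𝟙 (s ≡ᵇ sum (mask (isPetal j) profile)) * card (𝒜 i) * Ω
        ≡⟨ cong (λ x → 𝟙 (s ≡ᵇ x) * card (𝒜 i) * Ω) (sum-petal j) ⟩
      𝟙 (s ≡ᵇ c + 𝟙 (toℕ j <ᵇ m) * (s ∸ c)) * card (𝒜 i) * Ω
        ≡⟨ cong (λ b → 𝟙 b * card (𝒜 i) * Ω) (s≡ᵇpetal-size (toℕ j <ᵇ m)) ⟩
      𝟙 (toℕ j <ᵇ m) * card (𝒜 i) * Ω
        ≡⟨ *-assoc (𝟙 (toℕ j <ᵇ m)) (card (𝒜 i)) Ω ⟩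
      𝟙 (toℕ j <ᵇ m) * (card (𝒜 i) * Ω) ∎
      where open ≡-Reasoning

    ∑Lab-hitCount : ∑Lab n profile hitCount * (n C s) ≡ m * totalSize 𝒜 * Ω
    ∑Lab-hitCount = begin
      ∑Lab n profile hitCount * (n C s)
        ≡⟨ cong (_* (n C s)) (trans (∑Lab-sum n profile {k} λ r ω → ∑[ i < k ] 𝟙 (hits ω r i))
                                     (sum-cong-≗ λ r → ∑Lab-sum n profile {k} λ i ω → 𝟙 (hits ω r i))) ⟩
      ∑[ r < k ] ∑[ i < k ] ∑Lab n profile (λ ω → 𝟙 (hits ω r i)) * (n C s)
        ≡⟨ trans (*-distribʳ-sum {k} (n C s) λ r → ∑[ i < k ] ∑Lab n profile (λ ω → 𝟙 (hits ω r i)))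
                 (sum-cong-≗ λ r → *-distribʳ-sum {k} (n C s) λ i → ∑Lab n profile (λ ω → 𝟙 (hits ω r i))) ⟩
      ∑[ r < k ] ∑[ i < k ] (∑Lab n profile (λ ω → 𝟙 (hits ω r i)) * (n C s))
        ≡⟨ sum-cong-≗ (λ r → sum-cong-≗ λ i → ∑Lab-hits i (rotation r ⟨$⟩ʳ i)) ⟩
      ∑[ r < k ] ∑[ i < k ] (𝟙 (toℕ (rotation r ⟨$⟩ʳ i) <ᵇ m) * (card (𝒜 i) * Ω))
        ≡⟨ ∑-comm {k} {k} (λ r i → 𝟙 (toℕ (rotation r ⟨$⟩ʳ i) <ᵇ m) * (card (𝒜 i) * Ω)) ⟩
      ∑[ i < k ] ∑[ r < k ] (𝟙 (toℕ (rotation r ⟨$⟩ʳ i) <ᵇ m) * (card (𝒜 i) * Ω))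
        ≡⟨ sum-cong-≗ (λ i → *-distribʳ-sum {k} (card (𝒜 i) * Ω) λ r → 𝟙 (toℕ (rotation r ⟨$⟩ʳ i) <ᵇ m)) ⟨
      ∑[ i < k ] (∑[ r < k ] 𝟙 (toℕ (rotation r ⟨$⟩ʳ i) <ᵇ m) * (card (𝒜 i) * Ω))
        ≡⟨ sum-cong-≗ (λ i → cong (_* (card (𝒜 i) * Ω))
             (trans (∑-rotation (λ j → 𝟙 (toℕ j <ᵇ m)) i) (∑-𝟙<ᵇ m≤k))) ⟩
      ∑[ i < k ] (m * (card (𝒜 i) * Ω))
        ≡⟨ *-distribˡ-sum {k} m (λ i → card (𝒜 i) * Ω) ⟨
      m * ∑[ i < k ] (card (𝒜 i) * Ω)
        ≡⟨ cong (m *_) (*-distribʳ-sum {k} Ω (card ∘ 𝒜)) ⟨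
      m * (∑[ i < k ] card (𝒜 i) * Ω)
        ≡⟨ cong (λ x → m * (x * Ω)) (totalSize≡∑card 𝒜) ⟨
      m * (totalSize 𝒜 * Ω)
        ≡⟨ *-assoc m (totalSize 𝒜) Ω ⟨
      m * totalSize 𝒜 * Ω ∎
      where open ≡-Reasoning

sunflower-free⇒bound : ∀ {s t k c n m} .{{_ : NonZero k}} → c < s → m ≤ k → c + m * (s ∸ c) ≤ n →
  (𝒜 : Fin k → Family n) → (∀ i → Uniform s (𝒜 i)) → ¬ MulticolorSunflower 𝒜 t c →
  m * totalSize 𝒜 ≤ (t ∸ 1) * k * (n C s)
sunflower-free⇒bound {s} {t} {k} {c} {n} {m} c<s m≤k room 𝒜 uniform no-sunflower =
  *-cancelʳ-≤ (m * totalSize 𝒜) ((t ∸ 1) * k * (n C s)) Ω {{>-nonZero (∑Lab-positive n profile sum-profile)}} (begin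
    m * totalSize 𝒜 * Ω                ≡⟨ ∑Lab-hitCount ⟨
    ∑Lab n profile hitCount * (n C s)  ≤⟨ *-monoˡ-≤ (n C s) (∑Lab-hitCount-≤ no-sunflower) ⟩
    k * (t ∸ 1) * Ω * (n C s)          ≡⟨ rearrange k (t ∸ 1) Ω (n C s) ⟩
    (t ∸ 1) * k * (n C s) * Ω          ∎)
  where
  open Construction c<s m≤k room
  open Counting {t = t} 𝒜 uniform
  open ≤-Reasoning
  rearrange : ∀ x y z w → x * y * z * w ≡ y * x * w * z
  rearrange = solve-∀

c+[n∸c]/d*d≤n : ∀ {c n d} .{{_ : NonZero d}} → c ≤ n → c + (n ∸ c) / d * d ≤ n
c+[n∸c]/d*d≤n {c} {n} {d} c≤n = ≤-trans (+-monoʳ-≤ c (m/n*n≤m (n ∸ c) d)) (≤-reflexive (m+[n∸m]≡n c≤n))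

[n∸c]/d≤k : ∀ {c n d k} .{{_ : NonZero d}} → n ≤ c + k * d → (n ∸ c) / d ≤ k
[n∸c]/d≤k {c} {n} {d} {k} n≤c+kd = begin
  (n ∸ c) / d            ≤⟨ /-monoˡ-≤ d (∸-monoˡ-≤ c n≤c+kd) ⟩
  (c + k * d ∸ c) / d    ≡⟨ cong (_/ d) (m+n∸m≡n c (k * d)) ⟩
  k * d / d              ≡⟨ m*n/n≡m k d ⟩
  k                      ∎
  where open ≤-Reasoning

lemma3 : (s t k c n : ℕ) → 1 ≤ s → 1 ≤ t → t ≤ k → (c<s : c < s)
    → c + t * (s ∸ c) ≤ n
    → (𝒜 : Fin k → Family n) → ((i : Fin k) → Uniform s (𝒜 i))
    → ¬ MulticolorSunflower 𝒜 t c
    → (n ≤ c + k * (s ∸ c) → floorQuot n c s c<s * totalSize 𝒜 ≤ (t ∸ 1) * k * (n C s))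
      × (c + k * (s ∸ c) ≤ n → totalSize 𝒜 ≤ (t ∸ 1) * (n C s))
-- The hypothesis 1 ≤ s is implied by c < s.
lemma3 s t k c n _ 1≤t t≤k c<s c+t[s∸c]≤n 𝒜 uniform no-sunflower = few-blocks , many-blocks
  where
  instance
    k≢0 : NonZero k
    k≢0 = >-nonZero (≤-trans 1≤t t≤k)
    s∸c≢0 : NonZero (s ∸ c)
    s∸c≢0 = >-nonZero (m<n⇒0<n∸m c<s)

  few-blocks : n ≤ c + k * (s ∸ c) → floorQuot n c s c<s * totalSize 𝒜 ≤ (t ∸ 1) * k * (n C s)
  few-blocks n≤c+k[s∸c] = sunflower-free⇒bound c<s ([n∸c]/d≤k {d = s ∸ c} n≤c+k[s∸c])
    (c+[n∸c]/d*d≤n {d = s ∸ c} (≤-trans (m≤m+n c _) c+t[s∸c]≤n)) 𝒜 uniform no-sunflower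

  many-blocks : c + k * (s ∸ c) ≤ n → totalSize 𝒜 ≤ (t ∸ 1) * (n C s)
  many-blocks c+k[s∸c]≤n = *-cancelˡ-≤ k (begin
    k * totalSize 𝒜          ≤⟨ sunflower-free⇒bound c<s ≤-refl c+k[s∸c]≤n 𝒜 uniform no-sunflower ⟩
    (t ∸ 1) * k * (n C s)    ≡⟨ *-CS.xy∙z≈y∙xz (t ∸ 1) k (n C s) ⟩
    k * ((t ∸ 1) * (n C s))  ∎)
    where open ≤-Reasoning
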